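{- Let $(G,K,\mathbf{c},\overline{b})$ be a Steiner Tree instance such that $G$ is connected and $G[K]$ is not connected. If there is a module $M\in\Pi_{mod}(G)$ with $K\subseteq M$, then there is an optimum Steiner tree $X$ with $X\subseteq M$, or there is an optimum Steiner tree $X$ with $|X|=|K|+1$.
   Context: Steiner Tree instance: graph $G=(V,E)$, terminals $K\subseteq V$, costs $\mathbf{c}\colon V\to\mathbb{N}\setminus\{0\}$, integer $\overline{b}$. A Steiner tree is a set $X\subseteq V$ with $K\subseteq X$ and $G[X]$ connected; it is optimum if it minimizes $\mathbf{c}(X)=\sum_{v\in X}\mathbf{c}(v)$. A module of $G$ is $M\subseteq V$ with $N(v)\setminus M=N(w)\setminus M$ for all $v,w\in M$; strong if for every module $M'$: $M\cap M'=\emptyset$, $M\subseteq M'$ or $M'\subseteq M$. For a graph with at least two vertices, $\Pi_{mod}(G)$ is the partition of $V$ into the inclusion-maximal strong modules different from $V$. -}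

module Defs where

open import Data.Nat using (ℕ; zero; suc; _+_; _≤_)
open import Data.Bool using (Bool; true; false; if_then_else_)
open import Data.Fin using (Fin; zero; suc)
open import Data.Fin.Subset using (Subset; _∈_; _∉_; _⊆_; ⊤; ∣_∣)
open import Data.Vec using ([]; _∷_)
open import Data.Product using (_×_)
open import Data.Sum using (_⊎_)
open import Data.Empty using (⊥)
open import Relation.Binary.PropositionalEquality using (_≡_; _≢_)

record Graph (n : ℕ) : Set where
  field
    adj    : Fin n → Fin n → Bool
    sym    : ∀ u v → adj u v ≡ adj v u
    irrefl : ∀ v → adj v v ≡ false
open Graph public

Edge : ∀ {n} → Graph n → Fin n → Fin n → Set
Edge G u v = adj G u v ≡ true

data Reach {n : ℕ} (G : Graph n) (X : Subset n) : Fin n → Fin n → Set where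
  here : ∀ {u} → u ∈ X → Reach G X u u
  step : ∀ {u w v} → u ∈ X → Edge G u w → Reach G X w v → Reach G X u v

Connected : ∀ {n} → Graph n → Subset n → Set
Connected G X = ∀ u v → u ∈ X → v ∈ X → Reach G X u v

cost : ∀ {n} → (Fin n → ℕ) → Subset n → ℕ
cost c [] = 0
cost c (b ∷ X) = (if b then c zero else 0) + cost (λ i → c (suc i)) X

SteinerTree : ∀ {n} → Graph n → Subset n → Subset n → Set
SteinerTree G K X = K ⊆ X × Connected G X

OptimumSteinerTree : ∀ {n} → Graph n → Subset n → (Fin n → ℕ) → Subset n → Set
OptimumSteinerTree G K c X =
  SteinerTree G K X × (∀ Y → SteinerTree G K Y → cost c X ≤ cost c Y)

IsModule : ∀ {n} → Graph n → Subset n → Set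
IsModule G M = ∀ v w x → v ∈ M → w ∈ M → x ∉ M → adj G v x ≡ adj G w x

IsStrongModule : ∀ {n} → Graph n → Subset n → Set
IsStrongModule G M = IsModule G M ×
  (∀ M' → IsModule G M' → (∀ x → x ∈ M → x ∈ M' → ⊥) ⊎ (M ⊆ M' ⊎ M' ⊆ M))

InΠmod : ∀ {n} → Graph n → Subset n → Set
InΠmod G M = IsStrongModule G M × M ≢ ⊤ ×
  (∀ M' → IsStrongModule G M' → M' ≢ ⊤ → M ⊆ M' → M' ⊆ M)

-- Take any optimum Steiner tree Y. If Y ⊆ M we are done. Otherwise G[Y] contains a
-- walk from a terminal (one exists as G[K] is disconnected, and it lies in M) to a
-- vertex outside M, so some edge a b of G[Y] leaves M. Since M is a module, b is
-- adjacent to every vertex of M, hence to every terminal, so K ∪ {b} is a Steiner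
-- tree. It is contained in Y, so it costs no more than Y and is optimum as well.
module Submission where

open import Defs hiding (sym)
open import Data.Nat using (ℕ; _≤_; _<_; _+_; suc; z≤n)
open import Data.Nat.Properties using (≤-trans; +-monoʳ-≤; m≤n+m; +-suc; _<?_; ≮⇒≥)
open import Data.Nat.Induction using (<-wellFounded)
open import Data.Bool using (true; false)
import Data.Bool.Properties as Bool
open import Data.Fin using (Fin)
open import Data.Fin.Properties using (_≟_; any?; all?)
open import Data.Fin.Subset
  using (Subset; _⊆_; ⊤; ∣_∣; _∈_; _∉_; _∪_; _-_; ⁅_⁆; Nonempty)
open import Data.Fin.Subset.Properties
  using (_∈?_; _⊆?_; ∈⊤; drop-∷-⊆; anySubset?; x∈p∪q⁻; p⊆p∪q; q⊆p∪q;
         x∈⁅x⁆; x∈⁅y⁆⇒x≡y; nonempty?; ∣⁅x⁆∣≡1; p─q⊆p; x∈p∧x≢y⇒x∈p-y; x∈p⇒∣p-x∣<∣p∣)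
open import Data.Vec.Base using (_∷_; []; here; there)
open import Data.Product using (Σ; ∃; _×_; _,_)
open import Data.Sum using (_⊎_; inj₁; inj₂)
open import Data.Empty using (⊥-elim)
open import Function using (_∘_)
open import Induction.WellFounded using (Acc; acc)
open import Relation.Nullary using (¬_; Dec; yes; no)
open import Relation.Nullary.Decidable
  using (_×-dec_; _⊎-dec_; _→-dec_; ¬?; map′; decidable-stable)
open import Relation.Unary using (Decidable)
open import Relation.Binary.PropositionalEquality using (_≡_; refl; sym; trans; cong; module ≡-Reasoning)

⊆⊎∃∉ : ∀ {n} (p q : Subset n) → p ⊆ q ⊎ ∃ λ x → x ∈ p × x ∉ q
⊆⊎∃∉ p q with any? (λ x → x ∈? p ×-dec ¬? (x ∈? q))
... | yes witness = inj₂ witness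
... | no ∄ = inj₁ λ {x} x∈p → decidable-stable (x ∈? q) (λ x∉q → ∄ (x , x∈p , x∉q))

∣p∪q∣≡∣p∣+∣q∣ : ∀ {n} (p q : Subset n) → (∀ {x} → x ∈ p → x ∉ q) →
                ∣ p ∪ q ∣ ≡ ∣ p ∣ + ∣ q ∣
∣p∪q∣≡∣p∣+∣q∣ []          []          _        = refl
∣p∪q∣≡∣p∣+∣q∣ (true ∷ p)  (true ∷ q)  disjoint = ⊥-elim (disjoint here here)
∣p∪q∣≡∣p∣+∣q∣ (true ∷ p)  (false ∷ q) disjoint =
  cong suc (∣p∪q∣≡∣p∣+∣q∣ p q λ x∈p x∈q → disjoint (there x∈p) (there x∈q))
∣p∪q∣≡∣p∣+∣q∣ (false ∷ p) (true ∷ q)  disjoint =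
  trans (cong suc (∣p∪q∣≡∣p∣+∣q∣ p q λ x∈p x∈q → disjoint (there x∈p) (there x∈q)))
        (sym (+-suc ∣ p ∣ ∣ q ∣))
∣p∪q∣≡∣p∣+∣q∣ (false ∷ p) (false ∷ q) disjoint =
  ∣p∪q∣≡∣p∣+∣q∣ p q λ x∈p x∈q → disjoint (there x∈p) (there x∈q)

∣p∪⁅x⁆∣≡∣p∣+1 : ∀ {n} {p : Subset n} {x} → x ∉ p → ∣ p ∪ ⁅ x ⁆ ∣ ≡ ∣ p ∣ + 1
∣p∪⁅x⁆∣≡∣p∣+1 {p = p} {x} x∉p = begin
  ∣ p ∪ ⁅ x ⁆ ∣      ≡⟨ ∣p∪q∣≡∣p∣+∣q∣ p ⁅ x ⁆ disjoint ⟩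
  ∣ p ∣ + ∣ ⁅ x ⁆ ∣  ≡⟨ cong (∣ p ∣ +_) (∣⁅x⁆∣≡1 x) ⟩
  ∣ p ∣ + 1          ∎
  where
  open ≡-Reasoning
  disjoint : ∀ {y} → y ∈ p → y ∉ ⁅ x ⁆
  disjoint y∈p y∈⁅x⁆ rewrite x∈⁅y⁆⇒x≡y x y∈⁅x⁆ = x∉p y∈p

∪⁅⁆-⊆ : ∀ {n} {p q : Subset n} {x} → p ⊆ q → x ∈ q → p ∪ ⁅ x ⁆ ⊆ q
∪⁅⁆-⊆ {p = p} {x = x} p⊆q x∈q y∈p∪⁅x⁆ with x∈p∪q⁻ p ⁅ x ⁆ y∈p∪⁅x⁆
... | inj₁ y∈p = p⊆q y∈p
... | inj₂ y∈⁅x⁆ rewrite x∈⁅y⁆⇒x≡y x y∈⁅x⁆ = x∈q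

x∉p-x : ∀ {n} (p : Subset n) x → x ∉ p - x
x∉p-x (_ ∷ p) Fin.zero    ()
x∉p-x (_ ∷ p) (Fin.suc x) (there x∈p-x) = x∉p-x p x x∈p-x

cost-mono : ∀ {n} (c : Fin n → ℕ) {X Y : Subset n} → X ⊆ Y → cost c X ≤ cost c Y
cost-mono c {[]}        {[]}        _   = z≤n
cost-mono c {true ∷ X}  {true ∷ Y}  X⊆Y = +-monoʳ-≤ (c _) (cost-mono (c ∘ Fin.suc) (drop-∷-⊆ X⊆Y))
cost-mono c {true ∷ X}  {false ∷ Y} X⊆Y with X⊆Y here
... | ()
cost-mono c {false ∷ X} {_ ∷ Y}     X⊆Y =
  ≤-trans (cost-mono (c ∘ Fin.suc) (drop-∷-⊆ X⊆Y)) (m≤n+m _ _)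

module _ {n : ℕ} {P : Subset n → Set} (P? : Decidable P) (f : Subset n → ℕ) where

  Minimiser : Subset n → Set
  Minimiser X = P X × (∀ Y → P Y → f X ≤ f Y)

  minimiser : ∀ X → P X → ∃ Minimiser
  minimiser X₀ PX₀ = descend X₀ PX₀ (<-wellFounded (f X₀))
    where
    descend : ∀ X → P X → Acc _<_ (f X) → ∃ Minimiser
    descend X PX (acc smaller) with anySubset? (λ Y → P? Y ×-dec f Y <? f X)
    ... | yes (Y , PY , fY<fX) = descend Y PY (smaller fY<fX)
    ... | no ∄cheaper = X , PX , λ Y PY → ≮⇒≥ (λ fY<fX → ∄cheaper (Y , PY , fY<fX))

module _ {n : ℕ} (G : Graph n) where

  reach-start : ∀ {X u v} → Reach G X u v → u ∈ X
  reach-start (here u∈X)     = u∈X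
  reach-start (step u∈X _ _) = u∈X

  reach-mono : ∀ {X Y u v} → X ⊆ Y → Reach G X u v → Reach G Y u v
  reach-mono X⊆Y (here u∈X)       = here (X⊆Y u∈X)
  reach-mono X⊆Y (step u∈X uw wv) = step (X⊆Y u∈X) uw (reach-mono X⊆Y wv)

  ReachOnce : Subset n → Fin n → Fin n → Set
  ReachOnce X u v = u ≡ v ⊎ ∃ λ w → Edge G u w × Reach G (X - u) w v

  reach-avoiding⊎once : ∀ {X a v} u → Reach G X a v → Reach G (X - u) a v ⊎ ReachOnce X u v
  reach-avoiding⊎once {a = a} u (here a∈X) with a ≟ u
  ... | yes refl = inj₂ (inj₁ refl)
  ... | no a≢u   = inj₁ (here (x∈p∧x≢y⇒x∈p-y a∈X a≢u))
  reach-avoiding⊎once {a = a} u (step {w = w} a∈X aw wv) with reach-avoiding⊎once u wv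
  ... | inj₂ once = inj₂ once
  ... | inj₁ wv-avoiding with a ≟ u
  ...   | yes refl = inj₂ (inj₂ (w , aw , wv-avoiding))
  ...   | no a≢u   = inj₁ (step (x∈p∧x≢y⇒x∈p-y a∈X a≢u) aw wv-avoiding)

  reach⇒once : ∀ {X u v} → Reach G X u v → ReachOnce X u v
  reach⇒once {X} {u} uv with reach-avoiding⊎once u uv
  ... | inj₁ uv-avoiding = ⊥-elim (x∉p-x X u (reach-start uv-avoiding))
  ... | inj₂ once = once

  once⇒reach : ∀ {X u v} → u ∈ X → ReachOnce X u v → Reach G X u v
  once⇒reach u∈X (inj₁ refl)            = here u∈X
  once⇒reach u∈X (inj₂ (w , uw , wv)) = step u∈X uw (reach-mono (p─q⊆p _ _) wv)

  edge? : ∀ u w → Dec (Edge G u w)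
  edge? u w = adj G u w Bool.≟ true

  reach? : ∀ X → Acc _<_ ∣ X ∣ → ∀ u v → Dec (Reach G X u v)
  reach? X (acc smaller) u v with u ∈? X
  ... | no u∉X  = no (u∉X ∘ reach-start)
  ... | yes u∈X = map′ (once⇒reach u∈X) reach⇒once
    (u ≟ v ⊎-dec any? λ w → edge? u w ×-dec reach? (X - u) (smaller (x∈p⇒∣p-x∣<∣p∣ u∈X)) w v)

  connected? : ∀ X → Dec (Connected G X)
  connected? X = all? λ u → all? λ v →
    u ∈? X →-dec v ∈? X →-dec reach? X (<-wellFounded ∣ X ∣) u v

  steinerTree? : ∀ K X → Dec (SteinerTree G K X)
  steinerTree? K X = K ⊆? X ×-dec connected? X

  nonempty-of-¬connected : ∀ {X} → ¬ Connected G X → Nonempty X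
  nonempty-of-¬connected {X} ¬connected with nonempty? X
  ... | yes nonempty = nonempty
  ... | no empty = ⊥-elim (¬connected λ u _ u∈X _ → ⊥-elim (empty (u , u∈X)))

  leaving-edge : ∀ (M : Subset n) {Y a v} → Reach G Y a v → a ∈ M → v ∉ M →
                 ∃ λ x → ∃ λ y → x ∈ M × y ∈ Y × y ∉ M × Edge G x y
  leaving-edge M (here _)                   a∈M v∉M = ⊥-elim (v∉M a∈M)
  leaving-edge M {a = a} (step {w = w} _ aw wv) a∈M v∉M with w ∈? M
  ... | yes w∈M = leaving-edge M wv w∈M v∉M
  ... | no w∉M  = a , w , a∈M , reach-start wv , w∉M , aw

  module-adjacent : ∀ {M x y} → IsModule G M → x ∈ M → y ∉ M → Edge G x y →
                    ∀ {m} → m ∈ M → Edge G m y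
  module-adjacent M-module x∈M y∉M xy m∈M = trans (M-module _ _ _ m∈M x∈M y∉M) xy

  ∪⁅⁆-connected : ∀ {X b} → (∀ {x} → x ∈ X → Edge G x b) → Connected G (X ∪ ⁅ b ⁆)
  ∪⁅⁆-connected {X} {b} adjacent u v u∈Z v∈Z = via-b u∈Z (from-b v∈Z)
    where
    Z : Subset n
    Z = X ∪ ⁅ b ⁆

    from-b : ∀ {v} → v ∈ Z → Reach G Z b v
    from-b v∈Z with x∈p∪q⁻ X ⁅ b ⁆ v∈Z
    ... | inj₁ v∈X =
      step (q⊆p∪q X ⁅ b ⁆ (x∈⁅x⁆ b)) (trans (Graph.sym G b _) (adjacent v∈X)) (here v∈Z)
    ... | inj₂ v∈⁅b⁆ rewrite x∈⁅y⁆⇒x≡y b v∈⁅b⁆ = here v∈Z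

    via-b : ∀ {u v} → u ∈ Z → Reach G Z b v → Reach G Z u v
    via-b u∈Z bv with x∈p∪q⁻ X ⁅ b ⁆ u∈Z
    ... | inj₁ u∈X = step u∈Z (adjacent u∈X) bv
    ... | inj₂ u∈⁅b⁆ rewrite x∈⁅y⁆⇒x≡y b u∈⁅b⁆ = bv

optimum-⊆ : ∀ {n} {G : Graph n} {K Y Z : Subset n} (c : Fin n → ℕ) →
            OptimumSteinerTree G K c Y → SteinerTree G K Z → Z ⊆ Y → OptimumSteinerTree G K c Z
optimum-⊆ c (_ , Y-minimal) Z-steiner Z⊆Y =
  Z-steiner , λ W W-steiner → ≤-trans (cost-mono c Z⊆Y) (Y-minimal W W-steiner)

lemma10 : ∀ {n} (G : Graph n) (K : Subset n) (c : Fin n → ℕ) (b : ℕ) →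
    (∀ v → 1 ≤ c v) → 2 ≤ n →
    Connected G ⊤ → ¬ Connected G K →
    (M : Subset n) → InΠmod G M → K ⊆ M →
    Σ (Subset n) (λ X → OptimumSteinerTree G K c X × X ⊆ M)
    ⊎ Σ (Subset n) (λ X → OptimumSteinerTree G K c X × ∣ X ∣ ≡ ∣ K ∣ + 1)
lemma10 G K c _ _ _ G-connected K-disconnected M ((M-module , _) , _) K⊆M
  with minimiser (steinerTree? G K) (cost c) ⊤ ((λ _ → ∈⊤) , G-connected)
... | Y , Y-optimum@((K⊆Y , Y-connected) , _) with ⊆⊎∃∉ Y M
...   | inj₁ Y⊆M = inj₁ (Y , Y-optimum , Y⊆M)
...   | inj₂ (y , y∈Y , y∉M) with nonempty-of-¬connected G K-disconnected
...     | k , k∈K with leaving-edge G M (Y-connected k y (K⊆Y k∈K) y∈Y) (K⊆M k∈K) y∉M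
...       | u , v , u∈M , v∈Y , v∉M , uv =
  inj₂ (K ∪ ⁅ v ⁆ , optimum-⊆ c Y-optimum Z-steiner (∪⁅⁆-⊆ K⊆Y v∈Y) , ∣p∪⁅x⁆∣≡∣p∣+1 (v∉M ∘ K⊆M))
  where
  Z-steiner : SteinerTree G K (K ∪ ⁅ v ⁆)
  Z-steiner = p⊆p∪q ⁅ v ⁆ , ∪⁅⁆-connected G (module-adjacent G M-module u∈M v∉M uv ∘ K⊆M)
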